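{- (1) $(\mathcal H,\rightthreetimes,\overset{\circledast}{\Delta})$ is a unital infinitesimal bialgebra: $\rightthreetimes$ is associative with unit $1_{\mathbb K}$, $\overset{\circledast}{\Delta}$ is coassociative, and $\overset{\circledast}{\Delta}(x\rightthreetimes y)=\sum x_{(1)}\otimes(x_{(2)}\rightthreetimes y)+\sum(x\rightthreetimes y_{(1)})\otimes y_{(2)}-x\otimes y$ for all $x,y\in\mathcal H$. (2) $\delta$ is a coderivation for $\veebar$: for trees $t,w$, $\delta(t\veebar w)=\sum t_{(1)}\otimes(t_{(2)}\veebar w)+\sum(t\veebar w_{(1)})\otimes w_{(2)}$, where $\delta(x)=\sum x_{(1)}\otimes x_{(2)}$. (3) $(\bigoplus_{n\ge1}\mathbb K[\mathbf{PBT}_n],\rightthreetimes,\delta)$ is an infinitesimal bialgebra: $\delta$ is coassociative and $\delta(t\rightthreetimes w)=\sum t_{(1)}\otimes(t_{(2)}\rightthreetimes w)+\sum(t\rightthreetimes w_{(1)})\otimes w_{(2)}$ for trees $t,w$.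
   Context: Planar binary rooted trees: every internal vertex has two children; $\mathbf{PBT}_n$ = such trees with $n$ leaves, $\mathbf{PBT}_1=\{\vert\}$. $t\veebar w$ joins the roots of $t$ (left), $w$ (right) to a new root; $t\circ_1w$ identifies the root of $w$ with the leftmost leaf of $t$. $\mathcal H=\mathbb K1_{\mathbb K}\oplus\bigoplus_{n\ge1}\mathbb K[\mathbf{PBT}_n]$, graded by number of leaves. $\rightthreetimes$: $1_{\mathbb K}$ is a two-sided unit, $t\rightthreetimes w=w\circ_1(t\veebar\vert)$ for trees. $\overset{\circledast}{\Delta}(1_{\mathbb K})=1_{\mathbb K}\otimes1_{\mathbb K}$, $\overset{\circledast}{\Delta}(\vert)=1_{\mathbb K}\otimes\vert+\vert\otimes1_{\mathbb K}$, $\overset{\circledast}{\Delta}(t\veebar w)=\sum t_{(1)}\otimes(t_{(2)}\veebar w)+\sum(t\veebar w_{(1)})\otimes w_{(2)}-t\otimes w$ (Sweedler notation; $1_{\mathbb K}\veebar w=w$, $t\veebar1_{\mathbb K}=t$). For $t\in\mathbf{PBT}_n$ write $\overset{\circledast}{\Delta}(t)=\sum_{i=0}^nt^i_{(1)}\otimes t^i_{(2)}$ with $t^i_{(1)}$ of degree $i$, $t^i_{(2)}$ of degree $n-i$; then $\delta(t):=\sum_{i=0}^{n-1}t^{i+1}_{(1)}\otimes t^i_{(2)}\in\bigoplus_i\mathbb K[\mathbf{PBT}_{i+1}]\otimes\mathbb K[\mathbf{PBT}_{n-i}]$, extended linearly. -}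

module Defs where

open import Level using (Level; _⊔_)
open import Algebra.Bundles using (CommutativeRing)
open import Data.Nat using (ℕ; zero; suc)
import Data.Nat as ℕ
open import Data.List using (List; []; _∷_; _++_; map; upTo; concat)
open import Data.Product using (_×_; _,_; Σ; proj₁; proj₂)
import Data.Product.Properties as ×P
open import Data.Maybe using (Maybe; just; nothing)
import Data.Maybe.Properties as MaybeP
open import Relation.Nullary using (¬_; yes; no)
open import Relation.Binary.Definitions using (DecidableEquality)
open import Relation.Binary.PropositionalEquality using (_≡_; refl; cong₂)

-- Planar binary rooted trees.  `leaf` is the tree | (one leaf);
-- `t ⋎ w` is t ∨ w (veebar): roots of t (left) and w (right) joined
-- to a new root.  Every PBT arises uniquely this way.

infixr 6 _⋎_
data Tree : Set where
  leaf : Tree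
  _⋎_  : Tree → Tree → Tree

-- number of leaves: t ∈ PBT_n iff leaves t ≡ n
leaves : Tree → ℕ
leaves leaf    = 1
leaves (t ⋎ w) = leaves t ℕ.+ leaves w

_≟ᵀ_ : DecidableEquality Tree
leaf ≟ᵀ leaf = yes refl
leaf ≟ᵀ (_ ⋎ _) = no (λ ())
(_ ⋎ _) ≟ᵀ leaf = no (λ ())
(t ⋎ w) ≟ᵀ (t' ⋎ w') with t ≟ᵀ t' | w ≟ᵀ w'
... | yes refl | yes refl = yes refl
... | no p     | _        = no (λ { refl → p refl })
... | yes _    | no q     = no (λ { refl → q refl })

_∘₁_ : Tree → Tree → Tree
leaf    ∘₁ w = w
(l ⋎ r) ∘₁ w = (l ∘₁ w) ⋎ r

_⋌ᵀ_ : Tree → Tree → Tree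
t ⋌ᵀ w = w ∘₁ (t ⋎ leaf)

-- Basis of H: `nothing` stands for 1_K, `just t` for the tree t.

HB : Set
HB = Maybe Tree

deg : HB → ℕ
deg nothing  = 0
deg (just t) = leaves t

_≟ᴴ_ : DecidableEquality HB
_≟ᴴ_ = MaybeP.≡-dec _≟ᵀ_

_≟ᴴᴴ_ : DecidableEquality (HB × HB)
_≟ᴴᴴ_ = ×P.≡-dec _≟ᴴ_ _≟ᴴ_

_≟ᴴᴴᴴ_ : DecidableEquality (HB × (HB × HB))
_≟ᴴᴴᴴ_ = ×P.≡-dec _≟ᴴ_ _≟ᴴᴴ_

_≟ᵀᵀ_ : DecidableEquality (Tree × Tree)
_≟ᵀᵀ_ = ×P.≡-dec _≟ᵀ_ _≟ᵀ_

_≟ᵀᵀᵀ_ : DecidableEquality (Tree × (Tree × Tree))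
_≟ᵀᵀᵀ_ = ×P.≡-dec _≟ᵀ_ _≟ᵀᵀ_

_⋌ᴮ_ : HB → HB → HB
nothing ⋌ᴮ y       = y
just t  ⋌ᴮ nothing = just t
just t  ⋌ᴮ just w  = just (t ⋌ᵀ w)

_⋎ᴮ_ : HB → HB → HB
nothing ⋎ᴮ y       = y
just t  ⋎ᴮ nothing = just t
just t  ⋎ᴮ just w  = just (t ⋎ w)

IsField : ∀ {c ℓ} → CommutativeRing c ℓ → Set (c ⊔ ℓ)
IsField R = ¬ (0# ≈ 1#) × (∀ x → ¬ (x ≈ 0#) → Σ Carrier (λ y → x * y ≈ 1#))
  where open CommutativeRing R

-- Free K-modules K[B] as finite formal linear combinations; two
-- combinations are equal iff all coefficients agree.  The tensor
-- product K[A] ⊗ K[B] is identified with K[A × B] (basis a ⊗ b ↦ (a , b)),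
-- and K[A] ⊗ K[B] ⊗ K[C] with K[A × (B × C)].

module FreeModule {c ℓ} (R : CommutativeRing c ℓ) where
  open CommutativeRing R renaming (Carrier to K)

  Lin : Set → Set c
  Lin B = List (K × B)

  coeff : {B : Set} → DecidableEquality B → Lin B → B → K
  coeff d [] b = 0#
  coeff d ((k , x) ∷ xs) b with d x b
  ... | yes _ = k + coeff d xs b
  ... | no  _ = coeff d xs b

  EqL : {B : Set} → DecidableEquality B → Lin B → Lin B → Set ℓ
  EqL d x y = ∀ b → coeff d x b ≈ coeff d y b

  single : {B : Set} → B → Lin B
  single b = (1# , b) ∷ []

  infixl 6 _⊕_
  _⊕_ : {B : Set} → Lin B → Lin B → Lin B
  x ⊕ y = x ++ y

  scale : {B : Set} → K → Lin B → Lin B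
  scale k = map (λ p → (k * proj₁ p , proj₂ p))

  ⊖_ : {B : Set} → Lin B → Lin B
  ⊖ x = scale (- 1#) x

  ext : {A B : Set} → (A → Lin B) → Lin A → Lin B
  ext f []             = []
  ext f ((k , a) ∷ xs) = scale k (f a) ++ ext f xs

  bilin : {A B C : Set} → (A → B → Lin C) → Lin A → Lin B → Lin C
  bilin f x y = ext (λ a → ext (λ b → f a b) y) x

  infixr 7 _⊗_
  _⊗_ : {A B : Set} → Lin A → Lin B → Lin (A × B)
  x ⊗ y = bilin (λ a b → single (a , b)) x y

  _⊗ₘ_ : {A B A' B' : Set} → (A → Lin A') → (B → Lin B') → Lin (A × B) → Lin (A' × B')
  (f ⊗ₘ g) = ext (λ p → f (proj₁ p) ⊗ g (proj₂ p))

  reassoc : {A B C : Set} → Lin ((A × B) × C) → Lin (A × (B × C))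
  reassoc = ext (λ p → single (proj₁ (proj₁ p) , (proj₂ (proj₁ p) , proj₂ p)))

  infixl 7 _⋌_
  _⋌_ : Lin HB → Lin HB → Lin HB
  _⋌_ = bilin (λ a b → single (a ⋌ᴮ b))

  _⋌ₜ_ : Lin Tree → Lin Tree → Lin Tree
  _⋌ₜ_ = bilin (λ a b → single (a ⋌ᵀ b))

  Δᵀ : Tree → Lin (HB × HB)
  Δᵀ leaf    = (1# , (nothing , just leaf)) ∷ (1# , (just leaf , nothing)) ∷ []
  Δᵀ (t ⋎ w) =
       ext (λ p → single (proj₁ p , (proj₂ p ⋎ᴮ just w))) (Δᵀ t)
    ⊕ ext (λ p → single ((just t ⋎ᴮ proj₁ p) , proj₂ p)) (Δᵀ w)
    ⊕ ⊖ single (just t , just w)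

  Δᴮ : HB → Lin (HB × HB)
  Δᴮ nothing  = single (nothing , nothing)
  Δᴮ (just t) = Δᵀ t

  Δ : Lin HB → Lin (HB × HB)
  Δ = ext Δᴮ

  -- For t ∈ PBT_n, the degree-i component of Δ⊛(t) (first factor of
  -- degree i) is  t^i_(1) ⊗ t^i_(2);  δ(t) = Σ_{i<n} t^{i+1}_(1) ⊗ t^i_(2).
  -- Here this is computed by the bilinear contraction
  --   (a ⊗ b , a' ⊗ b') ↦ a ⊗ b'
  -- applied to (degree-(i+1) component, degree-i component).

  component : ℕ → Lin (HB × HB) → Lin (HB × HB)
  component i [] = []
  component i ((k , (a , b)) ∷ xs) with deg a ℕ.≟ i
  ... | yes _ = (k , (a , b)) ∷ component i xs
  ... | no  _ = component i xs

  -- a ⊗ b' viewed in K[PBT] ⊗ K[PBT] (both factors have degree ≥ 1)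
  pairᵀ : HB → HB → Lin (Tree × Tree)
  pairᵀ (just a) (just b) = single (a , b)
  pairᵀ _        _        = []

  contract : Lin (HB × HB) → Lin (HB × HB) → Lin (Tree × Tree)
  contract = bilin (λ p q → pairᵀ (proj₁ p) (proj₂ q))

  δᵀ : Tree → Lin (Tree × Tree)
  δᵀ t = concat (map (λ i → contract (component (suc i) (Δᵀ t)) (component i (Δᵀ t)))
                     (upTo (leaves t)))

  δ : Lin Tree → Lin (Tree × Tree)
  δ = ext δᵀ

module Statements {c ℓ} (R : CommutativeRing c ℓ) where
  open CommutativeRing R using () renaming (Carrier to K)
  open FreeModule R

  _≈H_ : Lin HB → Lin HB → Set ℓ
  _≈H_ = EqL _≟ᴴ_
  _≈HH_ : Lin (HB × HB) → Lin (HB × HB) → Set ℓ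
  _≈HH_ = EqL _≟ᴴᴴ_
  _≈HHH_ : Lin (HB × (HB × HB)) → Lin (HB × (HB × HB)) → Set ℓ
  _≈HHH_ = EqL _≟ᴴᴴᴴ_
  _≈TT_ : Lin (Tree × Tree) → Lin (Tree × Tree) → Set ℓ
  _≈TT_ = EqL _≟ᵀᵀ_
  _≈TTT_ : Lin (Tree × (Tree × Tree)) → Lin (Tree × (Tree × Tree)) → Set ℓ
  _≈TTT_ = EqL _≟ᵀᵀᵀ_

  one : Lin HB
  one = single nothing

  Part1 : Set (c ⊔ ℓ)
  Part1 =
      (∀ x y z → ((x ⋌ y) ⋌ z) ≈H (x ⋌ (y ⋌ z)))
    × (∀ x → (one ⋌ x) ≈H x)
    × (∀ x → (x ⋌ one) ≈H x)
    × (∀ x → reassoc ((Δᴮ ⊗ₘ single) (Δ x)) ≈HHH (single ⊗ₘ Δᴮ) (Δ x))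
    × (∀ x y → Δ (x ⋌ y) ≈HH
                 ( (single ⊗ₘ (λ b → single b ⋌ y)) (Δ x)
                 ⊕ ((λ a → x ⋌ single a) ⊗ₘ single) (Δ y)
                 ⊕ ⊖ (x ⊗ y)))

  Part2 : Set ℓ
  Part2 = ∀ t w → δᵀ (t ⋎ w) ≈TT
                    ( (single ⊗ₘ (λ b → single (b ⋎ w))) (δᵀ t)
                    ⊕ ((λ a → single (t ⋎ a)) ⊗ₘ single) (δᵀ w))

  Part3 : Set (c ⊔ ℓ)
  Part3 =
      (∀ x → reassoc ((δᵀ ⊗ₘ single) (δ x)) ≈TTT (single ⊗ₘ δᵀ) (δ x))
    × (∀ t w → δᵀ (t ⋌ᵀ w) ≈TT
                 ( (single ⊗ₘ (λ b → single (b ⋌ᵀ w))) (δᵀ t)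
                 ⊕ ((λ a → single (t ⋌ᵀ a)) ⊗ₘ single) (δᵀ w)))

-- By induction on t, Δ⊛(t) = Σ_{i=0}^{n} t^i_(1) ⊗ t^i_(2), where the i-th term cuts t into the
-- part spanned by its i leftmost leaves and the rest: in the recursive formula for Δ⊛(t ∨ w) the
-- two copies of t ⊗ w cancel against −t ⊗ w.  Hence δ(t) = Σ_{i<n} t^{i+1}_(1) ⊗ t^i_(2), and
-- splitting the leaves of t ∨ w into those of t and those of w shows that δ is a coderivation
-- of ∨, which is (2).  Δ⊛ is by definition a coderivation of ∨ with correction term −t ⊗ w.
-- For any coderivation D (with a correction term κ a ⊗ b) of a binary operation μ,
-- coassociativity of D at a and at b implies it at μ a b; as every tree is built from | by ∨,
-- Δ⊛ and δ are coassociative.  Finally t ⋌ | = t ∨ | and t ⋌ (w₁ ∨ w₂) = (t ⋌ w₁) ∨ w₂, so the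
-- Leibniz rules for ⋌ follow from those for ∨ by induction on the right factor, and ⋌ is
-- associative because grafting is.

module Submission where

open import Defs
open import Algebra.Bundles using (CommutativeRing; CommutativeMonoid)
open import Algebra.Structures using (IsCommutativeMonoid)
import Algebra.Solver.CommutativeMonoid as CommutativeMonoidSolver
import Algebra.Properties.CommutativeSemigroup as CommutativeSemigroupProperties
import Algebra.Properties.Ring as RingProperties
open import Data.List using ([]; _∷_; _++_; length; concat; applyUpTo)
import Data.List.Properties as List
open import Data.Maybe using (just; nothing; Is-just)
open import Data.Maybe.Relation.Unary.Any using (just)
open import Data.Nat as ℕ using (ℕ; zero; suc; _≤_; _<_; z≤n; s≤s)
import Data.Nat.Properties as ℕₚ
open import Data.Product as Product using (_×_; _,_; proj₁; proj₂; map₁; map₂)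
open import Data.Product.Instances
open import Function using (_∘_; id)
open import Relation.Binary.Bundles using (Setoid)
open import Relation.Binary.Structures using (IsDecEquivalence; IsEquivalence)
open import Relation.Binary.PropositionalEquality as ≡ using (_≡_; _≢_)
open import Relation.Binary.PropositionalEquality.Properties using (isDecEquivalence)
open import Relation.Binary.TypeClasses using (_≟_)
import Relation.Binary.Reasoning.Setoid as SetoidReasoning
open import Relation.Nullary using (yes; no; contradiction)

DecEq : Set → Set
DecEq B = IsDecEquivalence {A = B} _≡_

instance
  Tree-decEq : DecEq Tree
  Tree-decEq = isDecEquivalence _≟ᵀ_

  HB-decEq : DecEq HB
  HB-decEq = isDecEquivalence _≟ᴴ_

module Trees where
  open import Data.Nat using (_+_; _∸_; _≤?_)

  infixr 6 _⋎²_
  _⋎²_ : HB × HB → HB × HB → HB × HB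
  (l , r) ⋎² (l′ , r′) = l ⋎ᴮ l′ , r ⋎ᴮ r′

  -- cut t i = (t^i_(1) , t^i_(2)): the part of t spanned by its i leftmost leaves, and the rest.
  cut : Tree → ℕ → HB × HB
  cut leaf    zero    = nothing , just leaf
  cut leaf    (suc _) = just leaf , nothing
  cut (t ⋎ w) i       = cut t i ⋎² cut w (i ∸ leaves t)

  ⋎ᴮ-identityʳ : ∀ x → x ⋎ᴮ nothing ≡ x
  ⋎ᴮ-identityʳ nothing  = ≡.refl
  ⋎ᴮ-identityʳ (just _) = ≡.refl

  deg-⋎ᴮ : ∀ x y → deg (x ⋎ᴮ y) ≡ deg x + deg y
  deg-⋎ᴮ nothing  y        = ≡.refl
  deg-⋎ᴮ (just t) nothing  = ≡.sym (ℕₚ.+-identityʳ _)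
  deg-⋎ᴮ (just t) (just w) = ≡.refl

  cut-zero : ∀ t → cut t 0 ≡ (nothing , just t)
  cut-zero leaf = ≡.refl
  cut-zero (t ⋎ w) rewrite ℕₚ.0∸n≡0 (leaves t) | cut-zero t | cut-zero w = ≡.refl

  cut-≥ : ∀ t i → leaves t ≤ i → cut t i ≡ (just t , nothing)
  cut-≥ leaf    (suc i) _  = ≡.refl
  cut-≥ (t ⋎ w) i       le
    rewrite cut-≥ t i (ℕₚ.≤-trans (ℕₚ.m≤m+n (leaves t) (leaves w)) le)
          | cut-≥ w (i ∸ leaves t) (≡.subst (_≤ i ∸ leaves t) (ℕₚ.m+n∸m≡n (leaves t) (leaves w))
                                             (ℕₚ.∸-monoˡ-≤ (leaves t) le)) = ≡.refl

  cut-⋎ˡ : ∀ t w i → i ≤ leaves t → cut (t ⋎ w) i ≡ map₂ (_⋎ᴮ just w) (cut t i)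
  cut-⋎ˡ t w i i≤n rewrite ℕₚ.m≤n⇒m∸n≡0 i≤n | cut-zero w =
    ≡.cong (_, proj₂ (cut t i) ⋎ᴮ just w) (⋎ᴮ-identityʳ (proj₁ (cut t i)))

  cut-⋎ʳ : ∀ t w j → cut (t ⋎ w) (leaves t + j) ≡ map₁ (just t ⋎ᴮ_) (cut w j)
  cut-⋎ʳ t w j rewrite ℕₚ.m+n∸m≡n (leaves t) j | cut-≥ t (leaves t + j) (ℕₚ.m≤m+n (leaves t) j) = ≡.refl

  data Position (n : ℕ) : ℕ → Set where
    within : ∀ {i} → i ≤ n → Position n i
    beyond : ∀ j → Position n (n + j)

  position : ∀ n i → Position n i
  position n i with i ≤? n
  ... | yes i≤n = within i≤n
  ... | no  i≰n = ≡.subst (Position n) (ℕₚ.m+[n∸m]≡n (ℕₚ.≰⇒≥ i≰n)) (beyond (i ∸ n))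

  deg-cut : ∀ t i → i ≤ leaves t → deg (proj₁ (cut t i)) ≡ i
  deg-cut leaf zero          _ = ≡.refl
  deg-cut leaf (suc zero)    _ = ≡.refl
  deg-cut leaf (suc (suc i)) (s≤s ())
  deg-cut (t ⋎ w) i le with position (leaves t) i
  ... | within i≤n = ≡.trans (≡.cong (deg ∘ proj₁) (cut-⋎ˡ t w i i≤n)) (deg-cut t i i≤n)
  ... | beyond j  = begin
    deg (proj₁ (cut (t ⋎ w) (leaves t + j)))
      ≡⟨ ≡.cong (deg ∘ proj₁) (cut-⋎ʳ t w j) ⟩
    deg (just t ⋎ᴮ proj₁ (cut w j))
      ≡⟨ deg-⋎ᴮ (just t) (proj₁ (cut w j)) ⟩
    leaves t + deg (proj₁ (cut w j))
      ≡⟨ ≡.cong (leaves t +_) (deg-cut w j (ℕₚ.+-cancelˡ-≤ (leaves t) _ _ le)) ⟩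
    leaves t + j                              ∎
    where open ≡.≡-Reasoning

  just-⋎ᴮ : ∀ {x} y → Is-just x → Is-just (x ⋎ᴮ y)
  just-⋎ᴮ nothing  (just _) = just _
  just-⋎ᴮ (just _) (just _) = just _

  ⋎ᴮ-just : ∀ x w → Is-just (x ⋎ᴮ just w)
  ⋎ᴮ-just nothing  w = just _
  ⋎ᴮ-just (just _) w = just _

  cut-suc-is-justˡ : ∀ t i → Is-just (proj₁ (cut t (suc i)))
  cut-suc-is-justˡ leaf    i = just _
  cut-suc-is-justˡ (t ⋎ w) i = just-⋎ᴮ (proj₁ (cut w (suc i ∸ leaves t))) (cut-suc-is-justˡ t i)

  cut-<-is-justʳ : ∀ t i → i < leaves t → Is-just (proj₂ (cut t i))
  cut-<-is-justʳ leaf zero    _ = just _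
  cut-<-is-justʳ leaf (suc i) (s≤s ())
  cut-<-is-justʳ (t ⋎ w) i i<n+m with position (leaves t) i
  ... | within i≤n = ≡.subst (Is-just ∘ proj₂) (≡.sym (cut-⋎ˡ t w i i≤n)) (⋎ᴮ-just (proj₂ (cut t i)) w)
  ... | beyond j   = ≡.subst (Is-just ∘ proj₂) (≡.sym (cut-⋎ʳ t w j))
                             (cut-<-is-justʳ w j (ℕₚ.+-cancelˡ-< (leaves t) _ _ i<n+m))

  ∘₁-assoc : ∀ u v s → (u ∘₁ v) ∘₁ s ≡ u ∘₁ (v ∘₁ s)
  ∘₁-assoc leaf    v s = ≡.refl
  ∘₁-assoc (l ⋎ r) v s = ≡.cong (_⋎ r) (∘₁-assoc l v s)

  ⋌ᴮ-assoc : ∀ a b c → (a ⋌ᴮ b) ⋌ᴮ c ≡ a ⋌ᴮ (b ⋌ᴮ c)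
  ⋌ᴮ-assoc nothing  b        c        = ≡.refl
  ⋌ᴮ-assoc (just t) nothing  c        = ≡.refl
  ⋌ᴮ-assoc (just t) (just w) nothing  = ≡.refl
  ⋌ᴮ-assoc (just t) (just w) (just u) = ≡.cong just (≡.sym (∘₁-assoc u (w ⋎ leaf) (t ⋎ leaf)))

  ⋌ᴮ-identityʳ : ∀ a → a ⋌ᴮ nothing ≡ a
  ⋌ᴮ-identityʳ nothing  = ≡.refl
  ⋌ᴮ-identityʳ (just _) = ≡.refl

  ⋎ᴮ-leaf≡⋌ᴮ-leaf : ∀ a → a ⋎ᴮ just leaf ≡ a ⋌ᴮ just leaf
  ⋎ᴮ-leaf≡⋌ᴮ-leaf nothing  = ≡.refl
  ⋎ᴮ-leaf≡⋌ᴮ-leaf (just _) = ≡.refl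

  ⋌ᴮ-⋎ᴮ-assocˡ : ∀ a w₁ w₂ → (a ⋌ᴮ just w₁) ⋎ᴮ just w₂ ≡ a ⋌ᴮ just (w₁ ⋎ w₂)
  ⋌ᴮ-⋎ᴮ-assocˡ nothing  w₁ w₂ = ≡.refl
  ⋌ᴮ-⋎ᴮ-assocˡ (just _) w₁ w₂ = ≡.refl

  ⋌ᴮ-⋎ᴮ-assocʳ : ∀ t w₁ b → just t ⋌ᴮ (just w₁ ⋎ᴮ b) ≡ (just t ⋌ᴮ just w₁) ⋎ᴮ b
  ⋌ᴮ-⋎ᴮ-assocʳ t w₁ nothing  = ≡.refl
  ⋌ᴮ-⋎ᴮ-assocʳ t w₁ (just _) = ≡.refl

open Trees

module FreeModuleProperties {c ℓ} (R : CommutativeRing c ℓ) where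
  open CommutativeRing R renaming (Carrier to K)
  open FreeModule R public
  open RingProperties ring using (-1*x≈-x)

  -- EqL _≟_ from Defs, wrapped in a record so that both sides can be inferred from a proof.
  infix 4 _≋_
  record _≋_ {B : Set} {{_ : DecEq B}} (x y : Lin B) : Set ℓ where
    constructor coeffwise
    field coeff-≈ : ∀ b → coeff _≟_ x b ≈ coeff _≟_ y b
  open _≋_ public

  module _ {B : Set} {{_ : DecEq B}} where

    coeff-⊕ : ∀ (x y : Lin B) b → coeff _≟_ (x ⊕ y) b ≈ coeff _≟_ x b + coeff _≟_ y b
    coeff-⊕ []            y b = sym (+-identityˡ _)
    coeff-⊕ ((k , a) ∷ x) y b with a ≟ b
    ... | yes _ = trans (+-congˡ (coeff-⊕ x y b)) (sym (+-assoc _ _ _))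
    ... | no  _ = coeff-⊕ x y b

    coeff-scale : ∀ k (x : Lin B) b → coeff _≟_ (scale k x) b ≈ k * coeff _≟_ x b
    coeff-scale k []             b = sym (zeroʳ k)
    coeff-scale k ((k′ , a) ∷ x) b with a ≟ b
    ... | yes _ = trans (+-congˡ (coeff-scale k x b)) (sym (distribˡ k k′ _))
    ... | no  _ = coeff-scale k x b

    ≋-isEquivalence : IsEquivalence (_≋_ {B})
    ≋-isEquivalence = record
      { refl  = coeffwise λ _ → refl
      ; sym   = λ p → coeffwise λ b → sym (coeff-≈ p b)
      ; trans = λ p q → coeffwise λ b → trans (coeff-≈ p b) (coeff-≈ q b)
      }

    ≋-setoid : Setoid c ℓ
    ≋-setoid = record { isEquivalence = ≋-isEquivalence }

    open IsEquivalence ≋-isEquivalence public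
      using () renaming (refl to ≋-refl; sym to ≋-sym; trans to ≋-trans; reflexive to ≋-reflexive)

    ⊕-cong : ∀ {x y u v : Lin B} → x ≋ y → u ≋ v → x ⊕ u ≋ y ⊕ v
    ⊕-cong {x} {y} {u} {v} p q = coeffwise λ b → begin
      coeff _≟_ (x ⊕ u) b         ≈⟨ coeff-⊕ x u b ⟩
      coeff _≟_ x b + coeff _≟_ u b ≈⟨ +-cong (coeff-≈ p b) (coeff-≈ q b) ⟩
      coeff _≟_ y b + coeff _≟_ v b ≈⟨ coeff-⊕ y v b ⟨
      coeff _≟_ (y ⊕ v) b         ∎
      where open SetoidReasoning setoid

    ⊕-congˡ : ∀ x {u v : Lin B} → u ≋ v → x ⊕ u ≋ x ⊕ v
    ⊕-congˡ x = ⊕-cong (≋-refl {x})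

    ⊕-congʳ : ∀ u {x y : Lin B} → x ≋ y → x ⊕ u ≋ y ⊕ u
    ⊕-congʳ u p = ⊕-cong p (≋-refl {u})

    ⊕-comm : ∀ (x y : Lin B) → x ⊕ y ≋ y ⊕ x
    ⊕-comm x y = coeffwise λ b →
      trans (coeff-⊕ x y b) (trans (+-comm _ _) (sym (coeff-⊕ y x b)))

    ⊕-isCommutativeMonoid : IsCommutativeMonoid (_≋_ {B}) _⊕_ []
    ⊕-isCommutativeMonoid = record
      { isMonoid = record
        { isSemigroup = record
          { isMagma = record { isEquivalence = ≋-isEquivalence ; ∙-cong = ⊕-cong }
          ; assoc   = λ x y z → ≋-reflexive (List.++-assoc x y z)
          }
        ; identity = (λ _ → ≋-refl) , (λ x → ≋-reflexive (List.++-identityʳ x))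
        }
      ; comm = ⊕-comm
      }

    ⊕-commutativeMonoid : CommutativeMonoid c ℓ
    ⊕-commutativeMonoid = record { isCommutativeMonoid = ⊕-isCommutativeMonoid }

    open IsCommutativeMonoid ⊕-isCommutativeMonoid public
      using () renaming (assoc to ⊕-assoc; identityʳ to ⊕-identityʳ)

    open CommutativeSemigroupProperties (CommutativeMonoid.commutativeSemigroup ⊕-commutativeMonoid) public
      using (x∙yz≈y∙xz) renaming (interchange to ⊕-interchange)

    scale-cong : ∀ k {x y : Lin B} → x ≋ y → scale k x ≋ scale k y
    scale-cong k {x} {y} p = coeffwise λ b →
      trans (coeff-scale k x b) (trans (*-congˡ (coeff-≈ p b)) (sym (coeff-scale k y b)))

    scale-congˡ : ∀ {k k′} (x : Lin B) → k ≈ k′ → scale k x ≋ scale k′ x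
    scale-congˡ {k} {k′} x e = coeffwise λ b →
      trans (coeff-scale k x b) (trans (*-congʳ e) (sym (coeff-scale k′ x b)))

    scale-⊕ : ∀ k (x y : Lin B) → scale k (x ⊕ y) ≡ scale k x ⊕ scale k y
    scale-⊕ k = List.map-++ _

    scale-assoc : ∀ k k′ (x : Lin B) → scale k (scale k′ x) ≋ scale (k * k′) x
    scale-assoc k k′ x = coeffwise λ b →
      trans (coeff-scale k (scale k′ x) b) (trans (*-congˡ (coeff-scale k′ x b))
        (trans (sym (*-assoc _ _ _)) (sym (coeff-scale _ x b))))

    scale-identity : ∀ (x : Lin B) → scale 1# x ≋ x
    scale-identity x = coeffwise λ b → trans (coeff-scale 1# x b) (*-identityˡ _)

    scale-zero : ∀ (x : Lin B) → scale 0# x ≋ []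
    scale-zero x = coeffwise λ b → trans (coeff-scale 0# x b) (zeroˡ _)

    scale-distribʳ : ∀ k k′ (x : Lin B) → scale (k + k′) x ≋ scale k x ⊕ scale k′ x
    scale-distribʳ k k′ x = coeffwise λ b →
      trans (coeff-scale _ x b) (trans (distribʳ _ k k′)
        (sym (trans (coeff-⊕ (scale k x) _ b) (+-cong (coeff-scale k x b) (coeff-scale k′ x b)))))

    ⊖-inverseʳ : ∀ (x : Lin B) → x ⊕ ⊖ x ≋ []
    ⊖-inverseʳ x = coeffwise λ b →
      trans (coeff-⊕ x _ b) (trans (+-congˡ (trans (coeff-scale _ x b) (-1*x≈-x _))) (-‿inverseʳ _))

    ∷-cong : ∀ {k k′} a {x y : Lin B} → k ≈ k′ → x ≋ y → (k , a) ∷ x ≋ (k′ , a) ∷ y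
    ∷-cong {k} {k′} a {x} {y} e p = coeffwise coeff-∷
      where
        coeff-∷ : ∀ b → coeff _≟_ ((k , a) ∷ x) b ≈ coeff _≟_ ((k′ , a) ∷ y) b
        coeff-∷ b with a ≟ b
        ... | yes _ = +-cong e (coeff-≈ p b)
        ... | no  _ = coeff-≈ p b

    ext-single-id : ∀ (x : Lin B) → ext single x ≋ x
    ext-single-id []            = ≋-refl
    ext-single-id ((k , a) ∷ x) = ∷-cong a (*-identityʳ k) (ext-single-id x)

    remove : B → Lin B → Lin B
    remove a [] = []
    remove a ((k , b) ∷ x) with b ≟ a
    ... | yes _ = remove a x
    ... | no  _ = (k , b) ∷ remove a x

    length-remove : ∀ a (x : Lin B) → length (remove a x) ≤ length x
    length-remove a [] = z≤n
    length-remove a ((k , b) ∷ x) with b ≟ a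
    ... | yes _ = ℕₚ.m≤n⇒m≤1+n (length-remove a x)
    ... | no  _ = s≤s (length-remove a x)

    coeff-∷-≡ : ∀ k a (x : Lin B) → coeff _≟_ ((k , a) ∷ x) a ≈ k + coeff _≟_ x a
    coeff-∷-≡ k a x with a ≟ a
    ... | yes _   = refl
    ... | no  a≢a = contradiction ≡.refl a≢a

    coeff-∷-≢ : ∀ k {a b} (x : Lin B) → a ≢ b → coeff _≟_ ((k , a) ∷ x) b ≈ coeff _≟_ x b
    coeff-∷-≢ k {a} {b} x a≢b with a ≟ b
    ... | yes a≡b = contradiction a≡b a≢b
    ... | no  _   = refl

    coeff-remove-≡ : ∀ a (x : Lin B) → coeff _≟_ (remove a x) a ≈ 0#
    coeff-remove-≡ a [] = refl
    coeff-remove-≡ a ((k , b) ∷ x) with b ≟ a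
    ... | yes _   = coeff-remove-≡ a x
    ... | no  b≢a = trans (coeff-∷-≢ k (remove a x) b≢a) (coeff-remove-≡ a x)

    coeff-remove-≢ : ∀ a (x : Lin B) b → a ≢ b → coeff _≟_ (remove a x) b ≈ coeff _≟_ x b
    coeff-remove-≢ a [] b a≢b = refl
    coeff-remove-≢ a ((k , a′) ∷ x) b a≢b with a′ ≟ a
    ... | yes ≡.refl = trans (coeff-remove-≢ a x b a≢b) (sym (coeff-∷-≢ k x a≢b))
    ... | no  _ with a′ ≟ b
    ...   | yes _ = +-congˡ (coeff-remove-≢ a x b a≢b)
    ...   | no  _ = coeff-remove-≢ a x b a≢b

  module ≋-Reasoning {B : Set} {{_ : DecEq B}} = SetoidReasoning (≋-setoid {B})
  module ⊕-Solver {B : Set} {{_ : DecEq B}} = CommutativeMonoidSolver (⊕-commutativeMonoid {B})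

  module _ {B : Set} {{_ : DecEq B}} where

    ⊕-⊖-cancel : ∀ (x y z : Lin B) → x ⊕ (y ⊕ z) ⊕ ⊖ y ≋ x ⊕ z
    ⊕-⊖-cancel x y z = begin
      x ⊕ (y ⊕ z) ⊕ ⊖ y    ≈⟨ solve 4 (λ x y z u → (x ⊞ (y ⊞ z)) ⊞ u ⊜ (x ⊞ z) ⊞ (y ⊞ u)) ≋-refl x y z (⊖ y) ⟩
      x ⊕ z ⊕ (y ⊕ ⊖ y)    ≈⟨ ⊕-congˡ (x ⊕ z) (⊖-inverseʳ y) ⟩
      x ⊕ z ⊕ []           ≈⟨ ⊕-identityʳ (x ⊕ z) ⟩
      x ⊕ z                ∎
      where
        open ≋-Reasoning
        open ⊕-Solver using (solve; _⊜_) renaming (_⊕_ to _⊞_)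

    ⊕-scale-zero : ∀ (x y : Lin B) → x ⊕ scale 0# y ≋ x
    ⊕-scale-zero x y = ≋-trans (⊕-congˡ x (scale-zero y)) (⊕-identityʳ x)

  module _ {A B : Set} {{_ : DecEq A}} {{_ : DecEq B}} where

    ext-⊕ʳ : ∀ (f : A → Lin B) (x y : Lin A) → ext f (x ⊕ y) ≡ ext f x ⊕ ext f y
    ext-⊕ʳ f []            y = ≡.refl
    ext-⊕ʳ f ((k , a) ∷ x) y =
      ≡.trans (≡.cong (scale k (f a) ⊕_) (ext-⊕ʳ f x y)) (≡.sym (List.++-assoc (scale k (f a)) _ _))

    ext-scaleʳ : ∀ (f : A → Lin B) k (x : Lin A) → ext f (scale k x) ≋ scale k (ext f x)
    ext-scaleʳ f k []             = ≋-refl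
    ext-scaleʳ f k ((k′ , a) ∷ x) = begin
      scale (k * k′) (f a) ⊕ ext f (scale k x)
        ≈⟨ ⊕-cong (≋-sym (scale-assoc k k′ (f a))) (ext-scaleʳ f k x) ⟩
      scale k (scale k′ (f a)) ⊕ scale k (ext f x)
        ≡⟨ scale-⊕ k (scale k′ (f a)) (ext f x) ⟨
      scale k (scale k′ (f a) ⊕ ext f x)             ∎
      where open ≋-Reasoning

    ext-single : ∀ (f : A → Lin B) a → ext f (single a) ≋ f a
    ext-single f a = begin
      scale 1# (f a) ⊕ []   ≈⟨ ⊕-identityʳ _ ⟩
      scale 1# (f a)        ≈⟨ scale-identity (f a) ⟩
      f a                   ∎
      where open ≋-Reasoning

    ext-congˡ : ∀ {f g : A → Lin B} (x : Lin A) → (∀ a → f a ≋ g a) → ext f x ≋ ext g x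
    ext-congˡ []            f≋g = ≋-refl
    ext-congˡ ((k , a) ∷ x) f≋g = ⊕-cong (scale-cong k (f≋g a)) (ext-congˡ x f≋g)

    ext-⊕ˡ : ∀ (f g : A → Lin B) (x : Lin A) → ext (λ a → f a ⊕ g a) x ≋ ext f x ⊕ ext g x
    ext-⊕ˡ f g []            = ≋-refl
    ext-⊕ˡ f g ((k , a) ∷ x) = begin
      scale k (f a ⊕ g a) ⊕ ext (λ a → f a ⊕ g a) x
        ≈⟨ ⊕-cong (≋-reflexive (scale-⊕ k (f a) (g a))) (ext-⊕ˡ f g x) ⟩
      (scale k (f a) ⊕ scale k (g a)) ⊕ (ext f x ⊕ ext g x)
        ≈⟨ ⊕-interchange (scale k (f a)) (scale k (g a)) (ext f x) (ext g x) ⟩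
      (scale k (f a) ⊕ ext f x) ⊕ (scale k (g a) ⊕ ext g x)    ∎
      where open ≋-Reasoning

    ext-scaleˡ : ∀ (f : A → Lin B) k (x : Lin A) → ext (λ a → scale k (f a)) x ≋ scale k (ext f x)
    ext-scaleˡ f k []             = ≋-refl
    ext-scaleˡ f k ((k′ , a) ∷ x) = begin
      scale k′ (scale k (f a)) ⊕ ext (λ a → scale k (f a)) x
        ≈⟨ ⊕-cong (scale-assoc k′ k (f a)) (ext-scaleˡ f k x) ⟩
      scale (k′ * k) (f a) ⊕ scale k (ext f x)
        ≈⟨ ⊕-congʳ (scale k (ext f x)) (scale-congˡ (f a) (*-comm k′ k)) ⟩
      scale (k * k′) (f a) ⊕ scale k (ext f x)
        ≈⟨ ⊕-congʳ (scale k (ext f x)) (scale-assoc k k′ (f a)) ⟨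
      scale k (scale k′ (f a)) ⊕ scale k (ext f x)
        ≡⟨ scale-⊕ k (scale k′ (f a)) (ext f x) ⟨
      scale k (scale k′ (f a) ⊕ ext f x)                      ∎
      where open ≋-Reasoning

    ext-⊕³ˡ : ∀ (f g h : A → Lin B) (x : Lin A) →
              ext (λ a → f a ⊕ g a ⊕ h a) x ≋ ext f x ⊕ ext g x ⊕ ext h x
    ext-⊕³ˡ f g h x = ≋-trans (ext-⊕ˡ (λ a → f a ⊕ g a) h x) (⊕-congʳ (ext h x) (ext-⊕ˡ f g x))

    ext-⊕³ʳ : ∀ (f : A → Lin B) (x y z : Lin A) → ext f (x ⊕ y ⊕ z) ≡ ext f x ⊕ ext f y ⊕ ext f z
    ext-⊕³ʳ f x y z = ≡.trans (ext-⊕ʳ f (x ⊕ y) z) (≡.cong (_⊕ ext f z) (ext-⊕ʳ f x y))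

    ext-∷-remove : ∀ (f : A → Lin B) k a (x : Lin A) →
                   ext f ((k , a) ∷ x) ≋ scale (k + coeff _≟_ x a) (f a) ⊕ ext f (remove a x)
    ext-remove : ∀ (f : A → Lin B) a (x : Lin A) → ext f x ≋ scale (coeff _≟_ x a) (f a) ⊕ ext f (remove a x)

    ext-∷-remove f k a x = begin
      scale k (f a) ⊕ ext f x                    ≈⟨ ⊕-congˡ (scale k (f a)) (ext-remove f a x) ⟩
      scale k (f a) ⊕ (scale xₐ (f a) ⊕ ext f x′) ≈⟨ ⊕-assoc (scale k (f a)) (scale xₐ (f a)) (ext f x′) ⟨
      scale k (f a) ⊕ scale xₐ (f a) ⊕ ext f x′   ≈⟨ ⊕-congʳ (ext f x′) (scale-distribʳ k xₐ (f a)) ⟨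
      scale (k + xₐ) (f a) ⊕ ext f x′             ∎
      where
        open ≋-Reasoning
        xₐ = coeff _≟_ x a
        x′ = remove a x

    ext-remove f a []             = ≋-sym (⊕-congʳ [] (scale-zero (f a)))
    ext-remove f a ((k , a′) ∷ x) with a′ ≟ a
    ... | yes ≡.refl = ext-∷-remove f k a x
    ... | no  _      = ≋-trans (⊕-congˡ (scale k (f a′)) (ext-remove f a x))
                               (x∙yz≈y∙xz (scale k (f a′)) (scale (coeff _≟_ x a) (f a)) (ext f (remove a x)))

    -- The occurrences of the first basis element have coefficients summing to 0, and removing
    -- them all leaves a shorter vanishing combination.
    ext-vanishes : ∀ (f : A → Lin B) (x : Lin A) → x ≋ [] → ext f x ≋ []
    ext-vanishes f x = go (length x) x ℕₚ.≤-refl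
      where
        remove-vanishes : ∀ k a (x : Lin A) → (k , a) ∷ x ≋ [] → remove a x ≋ []
        remove-vanishes k a x kax≋0 = coeffwise coeff-0
          where
            coeff-0 : ∀ b → coeff _≟_ (remove a x) b ≈ 0#
            coeff-0 b with a ≟ b
            ... | yes ≡.refl = coeff-remove-≡ a x
            ... | no  a≢b    = trans (coeff-remove-≢ a x b a≢b)
                                 (trans (sym (coeff-∷-≢ k x a≢b)) (coeff-≈ kax≋0 b))

        go : ∀ n (x : Lin A) → length x ≤ n → x ≋ [] → ext f x ≋ []
        go _       []            _         _     = ≋-refl
        go (suc n) ((k , a) ∷ x) (s≤s len) kax≋0 = ≋-trans (ext-∷-remove f k a x)
          (⊕-cong (≋-trans (scale-congˡ (f a) (trans (sym (coeff-∷-≡ k a x)) (coeff-≈ kax≋0 a))) (scale-zero (f a)))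
                  (go n (remove a x) (ℕₚ.≤-trans (length-remove a x) len) (remove-vanishes k a x kax≋0)))

    ext-congʳ : ∀ (f : A → Lin B) {x y : Lin A} → x ≋ y → ext f x ≋ ext f y
    ext-congʳ f {x} {y} x≋y = begin
      ext f x                            ≈⟨ ⊕-identityʳ (ext f x) ⟨
      ext f x ⊕ []                       ≈⟨ ⊕-congˡ (ext f x) (⊖-inverseʳ (ext f y)) ⟨
      ext f x ⊕ (ext f y ⊕ ⊖ ext f y)    ≈⟨ ⊕-congˡ (ext f x) (⊕-comm (ext f y) _) ⟩
      ext f x ⊕ (⊖ ext f y ⊕ ext f y)    ≈⟨ ⊕-assoc (ext f x) _ _ ⟨
      (ext f x ⊕ ⊖ ext f y) ⊕ ext f y    ≈⟨ ⊕-congʳ (ext f y) (⊕-congˡ (ext f x) (ext-scaleʳ f _ y)) ⟨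
      (ext f x ⊕ ext f (⊖ y)) ⊕ ext f y  ≡⟨ ≡.cong (_⊕ ext f y) (ext-⊕ʳ f x (⊖ y)) ⟨
      ext f (x ⊕ ⊖ y) ⊕ ext f y          ≈⟨ ⊕-congʳ (ext f y) (ext-vanishes f (x ⊕ ⊖ y) x-y≋0) ⟩
      ext f y                            ∎
      where
        open ≋-Reasoning
        x-y≋0 : x ⊕ ⊖ y ≋ []
        x-y≋0 = ≋-trans (⊕-congʳ (⊖ y) x≋y) (⊖-inverseʳ y)

    ext-const-[] : ∀ (x : Lin A) → ext (λ _ → []) x ≡ ([] {A = K × B})
    ext-const-[] []      = ≡.refl
    ext-const-[] (_ ∷ x) = ext-const-[] x

  module _ {A B C : Set} {{_ : DecEq A}} {{_ : DecEq B}} {{_ : DecEq C}} where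

    ext-ext : ∀ (g : B → Lin C) (f : A → Lin B) (x : Lin A) → ext g (ext f x) ≋ ext (ext g ∘ f) x
    ext-ext g f []            = ≋-refl
    ext-ext g f ((k , a) ∷ x) = begin
      ext g (scale k (f a) ⊕ ext f x)          ≡⟨ ext-⊕ʳ g (scale k (f a)) (ext f x) ⟩
      ext g (scale k (f a)) ⊕ ext g (ext f x)  ≈⟨ ⊕-cong (ext-scaleʳ g k (f a)) (ext-ext g f x) ⟩
      scale k (ext g (f a)) ⊕ ext (ext g ∘ f) x ∎
      where open ≋-Reasoning

    ext-comm : ∀ (h : A → B → Lin C) (x : Lin A) (y : Lin B) →
               ext (λ a → ext (h a) y) x ≋ ext (λ b → ext (λ a → h a b) x) y
    ext-comm h []            y = ≋-reflexive (≡.sym (ext-const-[] y))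
    ext-comm h ((k , a) ∷ x) y = begin
      scale k (ext (h a) y) ⊕ ext (λ a → ext (h a) y) x
        ≈⟨ ⊕-cong (≋-sym (ext-scaleˡ (h a) k y)) (ext-comm h x y) ⟩
      ext (λ b → scale k (h a b)) y ⊕ ext (λ b → ext (λ a → h a b) x) y
        ≈⟨ ext-⊕ˡ (λ b → scale k (h a b)) (λ b → ext (λ a → h a b) x) y ⟨
      ext (λ b → scale k (h a b) ⊕ ext (λ a → h a b) x) y                 ∎
      where open ≋-Reasoning

  lift : {A B : Set} → (A → B) → Lin A → Lin B
  lift φ = ext (single ∘ φ)

  module _ {A B C : Set} {{_ : DecEq A}} {{_ : DecEq B}} {{_ : DecEq C}} where

    ext-lift : ∀ (g : B → Lin C) (φ : A → B) (x : Lin A) → ext g (lift φ x) ≋ ext (g ∘ φ) x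
    ext-lift g φ x = ≋-trans (ext-ext g (single ∘ φ) x) (ext-congˡ x (ext-single g ∘ φ))

    lift-lift : ∀ (ψ : B → C) (φ : A → B) (x : Lin A) → lift ψ (lift φ x) ≋ lift (ψ ∘ φ) x
    lift-lift ψ = ext-lift (single ∘ ψ)

  lift-ext-lift : ∀ {A B C E : Set} {{_ : DecEq A}} {{_ : DecEq B}} {{_ : DecEq C}} {{_ : DecEq E}}
                  (ψ : C → E) (φ : A → B → C) (f : A → Lin B) (x : Lin A) →
                  lift ψ (ext (λ a → lift (φ a) (f a)) x) ≋ ext (λ a → lift (ψ ∘ φ a) (f a)) x
  lift-ext-lift ψ φ f x = ≋-trans (ext-ext (single ∘ ψ) (λ a → lift (φ a) (f a)) x)
                                  (ext-congˡ x λ a → lift-lift ψ (φ a) (f a))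

  module _ {A B : Set} {{_ : DecEq A}} {{_ : DecEq B}} where

    lift-cong : ∀ {φ ψ : A → B} (x : Lin A) → (∀ a → φ a ≡ ψ a) → lift φ x ≋ lift ψ x
    lift-cong x φ≡ψ = ext-congˡ x (≋-reflexive ∘ ≡.cong single ∘ φ≡ψ)

  module _ {A B C : Set} {{_ : DecEq A}} {{_ : DecEq B}} {{_ : DecEq C}} where

    bilin-cong : ∀ (f : A → B → Lin C) {x x′ y y′} → x ≋ x′ → y ≋ y′ → bilin f x y ≋ bilin f x′ y′
    bilin-cong f {x′ = x′} x≋x′ y≋y′ =
      ≋-trans (ext-congʳ _ x≋x′) (ext-congˡ x′ λ a → ext-congʳ (f a) y≋y′)

    bilin-singleˡ : ∀ (f : A → B → Lin C) a y → bilin f (single a) y ≋ ext (f a) y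
    bilin-singleˡ f a y = ext-single (λ a → ext (f a) y) a

    bilin-singleʳ : ∀ (f : A → B → Lin C) x b → bilin f x (single b) ≋ ext (λ a → f a b) x
    bilin-singleʳ f x b = ext-congˡ x λ a → ext-single (f a) b

    bilin-single : ∀ (f : A → B → Lin C) a b → bilin f (single a) (single b) ≋ f a b
    bilin-single f a b = ≋-trans (ext-single (λ a → ext (f a) (single b)) a) (ext-single (f a) b)

  ⊗ₘ-singles : ∀ {A B A′ B′ : Set} {{_ : DecEq A}} {{_ : DecEq B}} {{_ : DecEq A′}} {{_ : DecEq B′}}
               (f : A → A′) (g : B → B′) (x : Lin (A × B)) →
               ((single ∘ f) ⊗ₘ (single ∘ g)) x ≋ lift (Product.map f g) x
  ⊗ₘ-singles f g x = ext-congˡ x λ p → bilin-single (λ a b → single (a , b)) (f (proj₁ p)) (g (proj₂ p))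

  ∑ : {B : Set} → ℕ → (ℕ → Lin B) → Lin B
  ∑ n f = concat (applyUpTo f n)

  module _ {B : Set} {{_ : DecEq B}} where

    ∑-cong : ∀ n {f g : ℕ → Lin B} → (∀ i → i < n → f i ≋ g i) → ∑ n f ≋ ∑ n g
    ∑-cong zero    f≋g = ≋-refl
    ∑-cong (suc n) f≋g = ⊕-cong (f≋g 0 (s≤s z≤n)) (∑-cong n λ i i<n → f≋g (suc i) (s≤s i<n))

    ∑-+ : ∀ m n (f : ℕ → Lin B) → ∑ (m ℕ.+ n) f ≡ ∑ m f ⊕ ∑ n (λ j → f (m ℕ.+ j))
    ∑-+ zero    n f = ≡.refl
    ∑-+ (suc m) n f = ≡.trans (≡.cong (f 0 ⊕_) (∑-+ m n (f ∘ suc))) (≡.sym (List.++-assoc (f 0) _ _))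

    ∑-vanishes : ∀ n (f : ℕ → Lin B) → (∀ j → j < n → f j ≋ []) → ∑ n f ≋ []
    ∑-vanishes zero    f f≋0 = ≋-refl
    ∑-vanishes (suc n) f f≋0 = ⊕-cong (f≋0 0 (s≤s z≤n)) (∑-vanishes n (f ∘ suc) λ j j<n → f≋0 (suc j) (s≤s j<n))

    ∑-concentrated : ∀ n (f : ℕ → Lin B) i → i < n → (∀ j → j < n → j ≢ i → f j ≋ []) → ∑ n f ≋ f i
    ∑-concentrated (suc n) f zero    _         f≋0 = ≋-trans
      (⊕-congˡ (f 0) (∑-vanishes n (f ∘ suc) λ j j<n → f≋0 (suc j) (s≤s j<n) λ ()))
      (⊕-identityʳ (f 0))
    ∑-concentrated (suc n) f (suc i) (s≤s i<n) f≋0 =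
      ⊕-cong (f≋0 0 (s≤s z≤n) λ ())
             (∑-concentrated n (f ∘ suc) i i<n λ j j<n j≢i → f≋0 (suc j) (s≤s j<n) (j≢i ∘ ℕₚ.suc-injective))

  ext-∑ : ∀ {A B : Set} {{_ : DecEq A}} {{_ : DecEq B}} (h : A → Lin B) n (f : ℕ → Lin A) →
          ext h (∑ n f) ≡ ∑ n (ext h ∘ f)
  ext-∑ h zero    f = ≡.refl
  ext-∑ h (suc n) f =
    ≡.trans (ext-⊕ʳ h (f 0) (∑ n (f ∘ suc))) (≡.cong (ext h (f 0) ⊕_) (ext-∑ h n (f ∘ suc)))

  module _ {B : Set} {{_ : DecEq B}} (μ : B → B → B) where
    private
      _·_ : Lin B → Lin B → Lin B
      _·_ = bilin (λ a b → single (μ a b))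

    bilin-assoc : (∀ a b c → μ (μ a b) c ≡ μ a (μ b c)) → ∀ x y z → (x · y) · z ≋ x · (y · z)
    bilin-assoc assoc x y z = begin
      (x · y) · z
        ≈⟨ ext-ext (λ c → lift (μ c) z) (λ a → lift (μ a) y) x ⟩
      ext (λ a → ext (λ c → lift (μ c) z) (lift (μ a) y)) x
        ≈⟨ ext-congˡ x (λ a → ext-lift (λ c → lift (μ c) z) (μ a) y) ⟩
      ext (λ a → ext (λ b → lift (μ (μ a b)) z) y) x
        ≈⟨ ext-congˡ x (λ a → ext-congˡ y λ b → lift-cong z (assoc a b)) ⟩
      ext (λ a → ext (λ b → lift (μ a ∘ μ b) z) y) x
        ≈⟨ ext-congˡ x (λ a → ext-congˡ y λ b → lift-lift (μ a) (μ b) z) ⟨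
      ext (λ a → ext (λ b → lift (μ a) (lift (μ b) z)) y) x
        ≈⟨ ext-congˡ x (λ a → ext-ext (single ∘ μ a) (λ b → lift (μ b) z) y) ⟨
      x · (y · z)                                                    ∎
      where open ≋-Reasoning

    bilin-identityˡ : ∀ {e} → (∀ b → μ e b ≡ b) → ∀ y → single e · y ≋ y
    bilin-identityˡ {e} identity y = ≋-trans (bilin-singleˡ (λ a b → single (μ a b)) e y)
      (≋-trans (lift-cong y identity) (ext-single-id y))

    bilin-identityʳ : ∀ {e} → (∀ a → μ a e ≡ a) → ∀ x → x · single e ≋ x
    bilin-identityʳ {e} identity x = ≋-trans (bilin-singleʳ (λ a b → single (μ a b)) x e)
      (≋-trans (lift-cong x identity) (ext-single-id x))

module Coderivation {c ℓ} (R : CommutativeRing c ℓ) {T : Set} {{_ : DecEq T}}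
                    (D : T → FreeModule.Lin R (T × T)) (κ : CommutativeRing.Carrier R) where
  open FreeModuleProperties R

  T³ : Set
  T³ = T × (T × T)

  D⊗idᴮ : T × T → Lin T³
  D⊗idᴮ p = lift (λ q → proj₁ q , (proj₂ q , proj₂ p)) (D (proj₁ p))

  id⊗Dᴮ : T × T → Lin T³
  id⊗Dᴮ p = lift (proj₁ p ,_) (D (proj₂ p))

  D⊗id : Lin (T × T) → Lin T³
  D⊗id = ext D⊗idᴮ

  id⊗D : Lin (T × T) → Lin T³
  id⊗D = ext id⊗Dᴮ

  IsCoassociativeAt : T → Set ℓ
  IsCoassociativeAt a = D⊗id (D a) ≋ id⊗D (D a)

  -- κ = −1 gives the unital infinitesimal Leibniz rule of Δ⊛, κ = 0 the infinitesimal one of δ.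
  IsCoderivationAt : (T → T → T) → T → T → Set ℓ
  IsCoderivationAt μ a b =
    D (μ a b) ≋ lift (map₂ (λ x → μ x b)) (D a) ⊕ lift (map₁ (μ a)) (D b) ⊕ scale κ (single (a , b))

  D⊗id-map₂ : ∀ (g : T → T) y → D⊗id (lift (map₂ g) y) ≋ lift (map₂ (map₂ g)) (D⊗id y)
  D⊗id-map₂ g y = ≋-trans (ext-lift D⊗idᴮ (map₂ g) y)
    (≋-sym (lift-ext-lift (map₂ (map₂ g)) (λ p q → proj₁ q , (proj₂ q , proj₂ p)) (D ∘ proj₁) y))

  id⊗D-map₁ : ∀ (f : T → T) y → id⊗D (lift (map₁ f) y) ≋ lift (map₁ f) (id⊗D y)
  id⊗D-map₁ f y = ≋-trans (ext-lift id⊗Dᴮ (map₁ f) y)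
    (≋-sym (lift-ext-lift (map₁ f) (λ p → proj₁ p ,_) (D ∘ proj₂) y))

  coderivation-lift : ∀ {μ : T → T → T} {a b} {C : Set} {{_ : DecEq C}} → IsCoderivationAt μ a b → (σ : T × T → C) →
                      lift σ (D (μ a b)) ≋ lift (σ ∘ map₂ (λ x → μ x b)) (D a) ⊕ lift (σ ∘ map₁ (μ a)) (D b)
                                           ⊕ scale κ (single (σ (a , b)))
  coderivation-lift {μ} {a} {b} leibniz σ = begin
    lift σ (D (μ a b))
      ≈⟨ ext-congʳ (single ∘ σ) leibniz ⟩
    lift σ (lift (map₂ (λ x → μ x b)) (D a) ⊕ lift (map₁ (μ a)) (D b) ⊕ scale κ (single (a , b)))
      ≡⟨ ext-⊕³ʳ (single ∘ σ) (lift (map₂ (λ x → μ x b)) (D a)) (lift (map₁ (μ a)) (D b)) (scale κ (single (a , b))) ⟩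
    lift σ (lift (map₂ (λ x → μ x b)) (D a)) ⊕ lift σ (lift (map₁ (μ a)) (D b)) ⊕ lift σ (scale κ (single (a , b)))
      ≈⟨ ⊕-cong (⊕-cong (lift-lift σ _ (D a)) (lift-lift σ _ (D b)))
                (≋-trans (ext-scaleʳ (single ∘ σ) κ (single (a , b))) (scale-cong κ (ext-single (single ∘ σ) (a , b)))) ⟩
    lift (σ ∘ map₂ (λ x → μ x b)) (D a) ⊕ lift (σ ∘ map₁ (μ a)) (D b) ⊕ scale κ (single (σ (a , b)))
      ∎
    where open ≋-Reasoning

  module _ {μ : T → T → T} (leibniz : ∀ a b → IsCoderivationAt μ a b) where

    module _ (a b : T) where

      -- Sweedler notation D a = Σ a₁ ⊗ a₂, D b = Σ b₁ ⊗ b₂, with juxtaposition for μ.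
      a₁⊗a₂b₁⊗b₂ : Lin T³
      a₁⊗a₂b₁⊗b₂ = ext (λ p → lift (λ q → proj₁ q , (μ (proj₂ q) (proj₁ p) , proj₂ p)) (D a)) (D b)

      a⊗b₁⊗b₂ : Lin T³
      a⊗b₁⊗b₂ = lift (a ,_) (D b)

      a₁⊗a₂⊗b : Lin T³
      a₁⊗a₂⊗b = lift (λ q → proj₁ q , (proj₂ q , b)) (D a)

      D⊗id-D-μ : D⊗id (D (μ a b)) ≋ lift (map₂ (map₂ (λ x → μ x b))) (D⊗id (D a))
                                    ⊕ (a₁⊗a₂b₁⊗b₂ ⊕ lift (map₁ (μ a)) (D⊗id (D b)) ⊕ scale κ a⊗b₁⊗b₂)
                                    ⊕ scale κ a₁⊗a₂⊗b
      D⊗id-D-μ = begin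
        D⊗id (D (μ a b))
          ≈⟨ ext-congʳ _ (leibniz a b) ⟩
        D⊗id (lift (map₂ (λ x → μ x b)) (D a) ⊕ lift (map₁ (μ a)) (D b) ⊕ scale κ (single (a , b)))
          ≡⟨ ext-⊕³ʳ _ (lift (map₂ (λ x → μ x b)) (D a)) (lift (map₁ (μ a)) (D b)) (scale κ (single (a , b))) ⟩
        D⊗id (lift (map₂ (λ x → μ x b)) (D a)) ⊕ D⊗id (lift (map₁ (μ a)) (D b)) ⊕ D⊗id (scale κ (single (a , b)))
          ≈⟨ ⊕-cong (⊕-cong (D⊗id-map₂ (λ x → μ x b) (D a)) middle) last ⟩
        lift (map₂ (map₂ (λ x → μ x b))) (D⊗id (D a))
          ⊕ (a₁⊗a₂b₁⊗b₂ ⊕ lift (map₁ (μ a)) (D⊗id (D b)) ⊕ scale κ a⊗b₁⊗b₂)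
          ⊕ scale κ a₁⊗a₂⊗b
          ∎
        where
          open ≋-Reasoning
          σ : T → T × T → T³
          σ t q = proj₁ q , (proj₂ q , t)
          middle : D⊗id (lift (map₁ (μ a)) (D b)) ≋ a₁⊗a₂b₁⊗b₂ ⊕ lift (map₁ (μ a)) (D⊗id (D b)) ⊕ scale κ a⊗b₁⊗b₂
          middle = begin
            D⊗id (lift (map₁ (μ a)) (D b))
              ≈⟨ ext-lift D⊗idᴮ (map₁ (μ a)) (D b) ⟩
            ext (λ p → lift (σ (proj₂ p)) (D (μ a (proj₁ p)))) (D b)
              ≈⟨ ext-congˡ (D b) (λ p → coderivation-lift (leibniz a (proj₁ p)) (σ (proj₂ p))) ⟩
            ext (λ p → lift (σ (proj₂ p) ∘ map₂ (λ x → μ x (proj₁ p))) (D a)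
                       ⊕ lift (σ (proj₂ p) ∘ map₁ (μ a)) (D (proj₁ p))
                       ⊕ scale κ (single (a , proj₁ p , proj₂ p))) (D b)
              ≈⟨ ext-⊕³ˡ _ _ _ (D b) ⟩
            a₁⊗a₂b₁⊗b₂ ⊕ ext (λ p → lift (map₁ (μ a) ∘ σ (proj₂ p)) (D (proj₁ p))) (D b)
                        ⊕ ext (λ p → scale κ (single (a , p))) (D b)
              ≈⟨ ⊕-cong (⊕-congˡ a₁⊗a₂b₁⊗b₂ (≋-sym (lift-ext-lift (map₁ (μ a)) (σ ∘ proj₂) (D ∘ proj₁) (D b))))
                        (ext-scaleˡ (single ∘ (a ,_)) κ (D b)) ⟩
            a₁⊗a₂b₁⊗b₂ ⊕ lift (map₁ (μ a)) (D⊗id (D b)) ⊕ scale κ a⊗b₁⊗b₂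
              ∎
          last : D⊗id (scale κ (single (a , b))) ≋ scale κ a₁⊗a₂⊗b
          last = ≋-trans (ext-scaleʳ D⊗idᴮ κ (single (a , b))) (scale-cong κ (ext-single D⊗idᴮ (a , b)))

      id⊗D-D-μ : id⊗D (D (μ a b)) ≋ lift (map₂ (map₂ (λ x → μ x b))) (id⊗D (D a)) ⊕ a₁⊗a₂b₁⊗b₂ ⊕ scale κ a₁⊗a₂⊗b
                                    ⊕ lift (map₁ (μ a)) (id⊗D (D b)) ⊕ scale κ a⊗b₁⊗b₂
      id⊗D-D-μ = begin
        id⊗D (D (μ a b))
          ≈⟨ ext-congʳ _ (leibniz a b) ⟩
        id⊗D (lift (map₂ (λ x → μ x b)) (D a) ⊕ lift (map₁ (μ a)) (D b) ⊕ scale κ (single (a , b)))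
          ≡⟨ ext-⊕³ʳ _ (lift (map₂ (λ x → μ x b)) (D a)) (lift (map₁ (μ a)) (D b)) (scale κ (single (a , b))) ⟩
        id⊗D (lift (map₂ (λ x → μ x b)) (D a)) ⊕ id⊗D (lift (map₁ (μ a)) (D b)) ⊕ id⊗D (scale κ (single (a , b)))
          ≈⟨ ⊕-cong (⊕-cong first (id⊗D-map₁ (μ a) (D b))) last ⟩
        lift (map₂ (map₂ (λ x → μ x b))) (id⊗D (D a)) ⊕ a₁⊗a₂b₁⊗b₂ ⊕ scale κ a₁⊗a₂⊗b
          ⊕ lift (map₁ (μ a)) (id⊗D (D b)) ⊕ scale κ a⊗b₁⊗b₂
          ∎
        where
          open ≋-Reasoning
          first : id⊗D (lift (map₂ (λ x → μ x b)) (D a))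
                  ≋ lift (map₂ (map₂ (λ x → μ x b))) (id⊗D (D a)) ⊕ a₁⊗a₂b₁⊗b₂ ⊕ scale κ a₁⊗a₂⊗b
          first = begin
            id⊗D (lift (map₂ (λ x → μ x b)) (D a))
              ≈⟨ ext-lift id⊗Dᴮ (map₂ (λ x → μ x b)) (D a) ⟩
            ext (λ p → lift (proj₁ p ,_) (D (μ (proj₂ p) b))) (D a)
              ≈⟨ ext-congˡ (D a) (λ p → coderivation-lift (leibniz (proj₂ p) b) (proj₁ p ,_)) ⟩
            ext (λ p → lift ((proj₁ p ,_) ∘ map₂ (λ x → μ x b)) (D (proj₂ p))
                       ⊕ lift ((proj₁ p ,_) ∘ map₁ (μ (proj₂ p))) (D b)
                       ⊕ scale κ (single (proj₁ p , proj₂ p , b))) (D a)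
              ≈⟨ ext-⊕³ˡ _ _ _ (D a) ⟩
            ext (λ p → lift (map₂ (map₂ (λ x → μ x b)) ∘ (proj₁ p ,_)) (D (proj₂ p))) (D a)
              ⊕ ext (λ p → lift ((proj₁ p ,_) ∘ map₁ (μ (proj₂ p))) (D b)) (D a)
              ⊕ ext (λ p → scale κ (single (proj₁ p , proj₂ p , b))) (D a)
              ≈⟨ ⊕-cong (⊕-cong (≋-sym (lift-ext-lift (map₂ (map₂ (λ x → μ x b))) (λ p → proj₁ p ,_) (D ∘ proj₂) (D a)))
                                (ext-comm (λ p q → single (proj₁ p , μ (proj₂ p) (proj₁ q) , proj₂ q)) (D a) (D b)))
                        (ext-scaleˡ (single ∘ λ q → proj₁ q , (proj₂ q , b)) κ (D a)) ⟩
            lift (map₂ (map₂ (λ x → μ x b))) (id⊗D (D a)) ⊕ a₁⊗a₂b₁⊗b₂ ⊕ scale κ a₁⊗a₂⊗b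
              ∎
          last : id⊗D (scale κ (single (a , b))) ≋ scale κ a⊗b₁⊗b₂
          last = ≋-trans (ext-scaleʳ id⊗Dᴮ κ (single (a , b))) (scale-cong κ (ext-single id⊗Dᴮ (a , b)))

      coassociative-μ : IsCoassociativeAt a → IsCoassociativeAt b → IsCoassociativeAt (μ a b)
      coassociative-μ coassoc-a coassoc-b = begin
        D⊗id (D (μ a b))
          ≈⟨ D⊗id-D-μ ⟩
        lift ·b (D⊗id (D a)) ⊕ (a₁⊗a₂b₁⊗b₂ ⊕ lift a· (D⊗id (D b)) ⊕ scale κ a⊗b₁⊗b₂) ⊕ scale κ a₁⊗a₂⊗b
          ≈⟨ ⊕-congʳ (scale κ a₁⊗a₂⊗b) (⊕-cong (ext-congʳ (single ∘ ·b) coassoc-a)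
               (⊕-congʳ (scale κ a⊗b₁⊗b₂) (⊕-congˡ a₁⊗a₂b₁⊗b₂ (ext-congʳ (single ∘ a·) coassoc-b)))) ⟩
        lift ·b (id⊗D (D a)) ⊕ (a₁⊗a₂b₁⊗b₂ ⊕ lift a· (id⊗D (D b)) ⊕ scale κ a⊗b₁⊗b₂) ⊕ scale κ a₁⊗a₂⊗b
          ≈⟨ solve 5 (λ u v w x y → (u ⊞ ((v ⊞ w) ⊞ x)) ⊞ y ⊜ (((u ⊞ v) ⊞ y) ⊞ w) ⊞ x) ≋-refl
                   (lift ·b (id⊗D (D a))) a₁⊗a₂b₁⊗b₂ (lift a· (id⊗D (D b))) (scale κ a⊗b₁⊗b₂) (scale κ a₁⊗a₂⊗b) ⟩
        lift ·b (id⊗D (D a)) ⊕ a₁⊗a₂b₁⊗b₂ ⊕ scale κ a₁⊗a₂⊗b ⊕ lift a· (id⊗D (D b)) ⊕ scale κ a⊗b₁⊗b₂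
          ≈⟨ id⊗D-D-μ ⟨
        id⊗D (D (μ a b))
          ∎
        where
          open ≋-Reasoning
          open ⊕-Solver using (solve; _⊜_) renaming (_⊕_ to _⊞_)
          ·b a· : T³ → T³
          ·b = map₂ (map₂ (λ x → μ x b))
          a· = map₁ (μ a)

    private
      infixl 7 _·_
      _·_ : Lin T → Lin T → Lin T
      _·_ = bilin (λ a b → single (μ a b))

    coderivation-ext : ∀ x y → ext D (x · y) ≋ (single ⊗ₘ (λ b → single b · y)) (ext D x)
                                               ⊕ ((λ a → x · single a) ⊗ₘ single) (ext D y)
                                               ⊕ scale κ (x ⊗ y)
    coderivation-ext x y = begin
      ext D (x · y)
        ≈⟨ ext-ext D (λ a → lift (μ a) y) x ⟩
      ext (λ a → ext D (lift (μ a) y)) x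
        ≈⟨ ext-congˡ x (λ a → ≋-trans (ext-lift D (μ a) y) (ext-congˡ y (leibniz a))) ⟩
      ext (λ a → ext (λ b → U a b ⊕ V a b ⊕ W a b) y) x
        ≈⟨ ext-congˡ x (λ a → ext-⊕³ˡ (U a) (V a) (W a) y) ⟩
      ext (λ a → ext (U a) y ⊕ ext (V a) y ⊕ ext (W a) y) x
        ≈⟨ ext-⊕³ˡ (λ a → ext (U a) y) (λ a → ext (V a) y) (λ a → ext (W a) y) x ⟩
      ext (λ a → ext (U a) y) x ⊕ ext (λ a → ext (V a) y) x ⊕ ext (λ a → ext (W a) y) x
        ≈⟨ ⊕-cong (⊕-cong left-terms right-terms) κ-terms ⟨
      (single ⊗ₘ (λ b → single b · y)) (ext D x) ⊕ ((λ a → x · single a) ⊗ₘ single) (ext D y) ⊕ scale κ (x ⊗ y)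
        ∎
      where
        open ≋-Reasoning
        U V W : T → T → Lin (T × T)
        U a b = lift (map₂ (λ z → μ z b)) (D a)
        V a b = lift (map₁ (μ a)) (D b)
        W a b = scale κ (single (a , b))
        left-terms : (single ⊗ₘ (λ b → single b · y)) (ext D x) ≋ ext (λ a → ext (U a) y) x
        left-terms = ≋-trans (ext-ext _ D x) (ext-congˡ x λ a → ≋-trans
          (ext-congˡ (D a) λ p → ≋-trans (bilin-singleˡ (λ a b → single (a , b)) (proj₁ p) (single (proj₂ p) · y))
                                  (≋-trans (ext-congʳ (single ∘ (proj₁ p ,_)) (bilin-singleˡ (λ a b → single (μ a b)) (proj₂ p) y))
                                           (lift-lift (proj₁ p ,_) (μ (proj₂ p)) y)))
          (ext-comm (λ p b → single (proj₁ p , μ (proj₂ p) b)) (D a) y))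
        right-terms : ((λ a → x · single a) ⊗ₘ single) (ext D y) ≋ ext (λ a → ext (V a) y) x
        right-terms = ≋-trans (ext-ext _ D y) (≋-trans (ext-congˡ y λ b → ≋-trans
          (ext-congˡ (D b) λ p → ≋-trans (bilin-singleʳ (λ a b → single (a , b)) (x · single (proj₁ p)) (proj₂ p))
                                  (≋-trans (ext-congʳ (single ∘ (_, proj₂ p)) (bilin-singleʳ (λ a b → single (μ a b)) x (proj₁ p)))
                                           (lift-lift (_, proj₂ p) (λ a → μ a (proj₁ p)) x)))
          (ext-comm (λ p a → single (μ a (proj₁ p) , proj₂ p)) (D b) x))
          (≋-sym (ext-comm (λ a b → V a b) x y)))
        κ-terms : scale κ (x ⊗ y) ≋ ext (λ a → ext (W a) y) x
        κ-terms = ≋-sym (≋-trans (ext-congˡ x λ a → ext-scaleˡ (λ b → single (a , b)) κ y)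
                                 (ext-scaleˡ (λ a → ext (λ b → single (a , b)) y) κ x))

  reassoc-D⊗single : ∀ y → reassoc ((D ⊗ₘ single) y) ≋ D⊗id y
  reassoc-D⊗single y = ≋-trans (ext-ext (single ∘ ρ) (λ p → D (proj₁ p) ⊗ single (proj₂ p)) y)
    (ext-congˡ y λ p → ≋-trans (ext-congʳ (single ∘ ρ) (bilin-singleʳ (λ a b → single (a , b)) (D (proj₁ p)) (proj₂ p)))
                               (lift-lift ρ (_, proj₂ p) (D (proj₁ p))))
    where
      ρ : (T × T) × T → T³
      ρ ((a , b) , c) = a , (b , c)

  single⊗D : ∀ y → (single ⊗ₘ D) y ≋ id⊗D y
  single⊗D y = ext-congˡ y λ p → bilin-singleˡ (λ a b → single (a , b)) (proj₁ p) (D (proj₂ p))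

  coassociative-ext : (∀ a → IsCoassociativeAt a) → ∀ x → reassoc ((D ⊗ₘ single) (ext D x)) ≋ (single ⊗ₘ D) (ext D x)
  coassociative-ext coassoc x = begin
    reassoc ((D ⊗ₘ single) (ext D x))  ≈⟨ reassoc-D⊗single (ext D x) ⟩
    D⊗id (ext D x)                     ≈⟨ ext-ext D⊗idᴮ D x ⟩
    ext (D⊗id ∘ D) x                   ≈⟨ ext-congˡ x coassoc ⟩
    ext (id⊗D ∘ D) x                   ≈⟨ ext-ext id⊗Dᴮ D x ⟨
    id⊗D (ext D x)                     ≈⟨ single⊗D (ext D x) ⟨
    (single ⊗ₘ D) (ext D x)            ∎
    where open ≋-Reasoning

  coderivation-graft : ∀ (μ ν : T → T → T) {a w₁ w₂} →
                       (∀ y → ν (μ y w₁) w₂ ≡ μ y (ν w₁ w₂)) → (∀ x → μ a (ν w₁ x) ≡ ν (μ a w₁) x) →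
                       IsCoderivationAt μ a w₁ → IsCoderivationAt ν w₁ w₂ → IsCoderivationAt ν (μ a w₁) w₂ →
                       IsCoderivationAt μ a (ν w₁ w₂)
  coderivation-graft μ ν {a} {w₁} {w₂} graftˡ graftʳ μ-a-w₁ ν-w₁-w₂ ν-aw₁-w₂ = begin
    D (μ a (ν w₁ w₂))
      ≡⟨ ≡.cong D (graftʳ w₂) ⟩
    D (ν (μ a w₁) w₂)
      ≈⟨ ν-aw₁-w₂ ⟩
    lift (map₂ (λ z → ν z w₂)) (D (μ a w₁)) ⊕ Q ⊕ κ[aw₁,w₂]
      ≈⟨ ⊕-congʳ κ[aw₁,w₂] (⊕-congʳ Q (coderivation-lift μ-a-w₁ (map₂ (λ z → ν z w₂)))) ⟩
    lift (map₂ (λ z → ν (μ z w₁) w₂)) (D a) ⊕ P ⊕ κ[a,w₁w₂] ⊕ Q ⊕ κ[aw₁,w₂]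
      ≈⟨ solve 5 (λ u v w x y → (((u ⊞ v) ⊞ w) ⊞ x) ⊞ y ⊜ (u ⊞ ((v ⊞ x) ⊞ y)) ⊞ w) ≋-refl
               (lift (map₂ (λ z → ν (μ z w₁) w₂)) (D a)) P κ[a,w₁w₂] Q κ[aw₁,w₂] ⟩
    lift (map₂ (λ z → ν (μ z w₁) w₂)) (D a) ⊕ (P ⊕ Q ⊕ κ[aw₁,w₂]) ⊕ κ[a,w₁w₂]
      ≈⟨ ⊕-cong (⊕-cong (lift-cong (D a) λ p → ≡.cong (proj₁ p ,_) (graftˡ (proj₂ p)))
                        (⊕-congʳ κ[aw₁,w₂] (⊕-congˡ P Q≋grafted)))
                ≋-refl ⟩
    lift (map₂ (λ z → μ z (ν w₁ w₂))) (D a) ⊕ (P ⊕ lift (map₁ (μ a) ∘ map₁ (ν w₁)) (D w₂) ⊕ κ[aw₁,w₂]) ⊕ κ[a,w₁w₂]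
      ≈⟨ ⊕-congʳ κ[a,w₁w₂] (⊕-congˡ _ (coderivation-lift ν-w₁-w₂ (map₁ (μ a)))) ⟨
    lift (map₂ (λ z → μ z (ν w₁ w₂))) (D a) ⊕ lift (map₁ (μ a)) (D (ν w₁ w₂)) ⊕ κ[a,w₁w₂]
      ∎
    where
      open ≋-Reasoning
      open ⊕-Solver using (solve; _⊜_) renaming (_⊕_ to _⊞_)
      P Q κ[a,w₁w₂] κ[aw₁,w₂] : Lin (T × T)
      P = lift (map₂ (λ z → ν z w₂) ∘ map₁ (μ a)) (D w₁)
      Q = lift (map₁ (ν (μ a w₁))) (D w₂)
      κ[a,w₁w₂] = scale κ (single (a , ν w₁ w₂))
      κ[aw₁,w₂] = scale κ (single (μ a w₁ , w₂))
      Q≋grafted : Q ≋ lift (map₁ (μ a) ∘ map₁ (ν w₁)) (D w₂)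
      Q≋grafted = lift-cong (D w₂) λ p → ≡.cong (_, proj₂ p) (≡.sym (graftʳ (proj₁ p)))

module CutExpansion {c ℓ} (R : CommutativeRing c ℓ) where
  open import Data.Nat using (_+_)
  open CommutativeRing R using (sym; *-identityʳ)
  open FreeModuleProperties R

  Δᵀ-cuts : ∀ t → Δᵀ t ≋ ∑ (suc (leaves t)) (single ∘ cut t)
  Δᵀ-cuts leaf    = ≋-refl
  Δᵀ-cuts (t ⋎ w) = begin
    lift F (Δᵀ t) ⊕ lift G (Δᵀ w) ⊕ ⊖ s
      ≈⟨ ⊕-congʳ (⊖ s) (⊕-cong (ext-congʳ (single ∘ F) (Δᵀ-cuts t)) (ext-congʳ (single ∘ G) (Δᵀ-cuts w))) ⟩
    lift F (∑ (suc n) (single ∘ cut t)) ⊕ lift G (∑ (suc m) (single ∘ cut w)) ⊕ ⊖ s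
      ≡⟨ ≡.cong₂ (λ u v → u ⊕ v ⊕ ⊖ s) (ext-∑ (single ∘ F) (suc n) (single ∘ cut t))
                                        (ext-∑ (single ∘ G) (suc m) (single ∘ cut w)) ⟩
    ∑ (suc n) (lift F ∘ single ∘ cut t) ⊕ ∑ (suc m) (lift G ∘ single ∘ cut w) ⊕ ⊖ s
      ≈⟨ ⊕-congʳ (⊖ s) (⊕-cong (∑-cong (suc n) left-terms) (⊕-cong first-right-term (∑-cong m right-terms))) ⟩
    ∑ (suc n) (single ∘ cut (t ⋎ w)) ⊕ (s ⊕ ∑ m (single ∘ cut (t ⋎ w) ∘ (suc n +_))) ⊕ ⊖ s
      ≈⟨ ⊕-⊖-cancel (∑ (suc n) (single ∘ cut (t ⋎ w))) s (∑ m (single ∘ cut (t ⋎ w) ∘ (suc n +_))) ⟩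
    ∑ (suc n) (single ∘ cut (t ⋎ w)) ⊕ ∑ m (single ∘ cut (t ⋎ w) ∘ (suc n +_))
      ≡⟨ ∑-+ (suc n) m (single ∘ cut (t ⋎ w)) ⟨
    ∑ (suc (n + m)) (single ∘ cut (t ⋎ w)) ∎
    where
      open ≋-Reasoning
      n = leaves t
      m = leaves w
      F G : HB × HB → HB × HB
      F = map₂ (_⋎ᴮ just w)
      G = map₁ (just t ⋎ᴮ_)
      s : Lin (HB × HB)
      s = single (just t , just w)
      left-terms : ∀ i → i < suc n → lift F (single (cut t i)) ≋ single (cut (t ⋎ w) i)
      left-terms i (s≤s i≤n) = ≋-trans (ext-single (single ∘ F) (cut t i)) (≋-reflexive (≡.cong single (≡.sym (cut-⋎ˡ t w i i≤n))))
      first-right-term : lift G (single (cut w 0)) ≋ s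
      first-right-term = ≋-trans (ext-single (single ∘ G) (cut w 0)) (≋-reflexive (≡.cong (single ∘ G) (cut-zero w)))
      right-terms : ∀ j → j < m → lift G (single (cut w (suc j))) ≋ single (cut (t ⋎ w) (suc n + j))
      right-terms j _ = ≋-trans (ext-single (single ∘ G) (cut w (suc j)))
        (≋-reflexive (≡.cong single (≡.trans (≡.sym (cut-⋎ʳ t w (suc j))) (≡.cong (cut (t ⋎ w)) (ℕₚ.+-suc n j)))))

  component-single-∈ : ∀ i (p : HB × HB) → deg (proj₁ p) ≡ i → component i (single p) ≡ single p
  component-single-∈ i (a , b) eq with deg a ℕ.≟ i
  ... | yes _ = ≡.refl
  ... | no  ≢ = contradiction eq ≢

  component-single-∉ : ∀ i (p : HB × HB) → deg (proj₁ p) ≢ i → component i (single p) ≡ []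
  component-single-∉ i (a , b) ≢ with deg a ℕ.≟ i
  ... | yes eq = contradiction eq ≢
  ... | no  _  = ≡.refl

  component-linear : ∀ i (x : Lin (HB × HB)) → component i x ≋ ext (component i ∘ single) x
  component-linear i [] = ≋-refl
  component-linear i ((k , (a , b)) ∷ x) with deg a ℕ.≟ i
  ... | yes _ = ∷-cong (a , b) (sym (*-identityʳ k)) (component-linear i x)
  ... | no  _ = component-linear i x

  component-cong : ∀ i {x y : Lin (HB × HB)} → x ≋ y → component i x ≋ component i y
  component-cong i {x} {y} x≋y =
    ≋-trans (component-linear i x) (≋-trans (ext-congʳ _ x≋y) (≋-sym (component-linear i y)))

  component-Δᵀ : ∀ t i → i ≤ leaves t → component i (Δᵀ t) ≋ single (cut t i)
  component-Δᵀ t i i≤n = begin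
    component i (Δᵀ t)                          ≈⟨ component-cong i (Δᵀ-cuts t) ⟩
    component i (∑ (suc n) (single ∘ cut t))    ≈⟨ component-linear i (∑ (suc n) (single ∘ cut t)) ⟩
    ext π (∑ (suc n) (single ∘ cut t))          ≡⟨ ext-∑ π (suc n) (single ∘ cut t) ⟩
    ∑ (suc n) (ext π ∘ single ∘ cut t)          ≈⟨ ∑-concentrated (suc n) _ i (s≤s i≤n) off-diagonal ⟩
    ext π (single (cut t i))                    ≈⟨ ext-single π (cut t i) ⟩
    component i (single (cut t i))              ≡⟨ component-single-∈ i (cut t i) (deg-cut t i i≤n) ⟩
    single (cut t i)                            ∎
    where
      open ≋-Reasoning
      n = leaves t
      π : HB × HB → Lin (HB × HB)
      π = component i ∘ single
      off-diagonal : ∀ j → j < suc n → j ≢ i → ext π (single (cut t j)) ≋ []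
      off-diagonal j (s≤s j≤n) j≢i = ≋-trans (ext-single π (cut t j))
        (≋-reflexive (component-single-∉ i (cut t j) (j≢i ∘ ≡.trans (≡.sym (deg-cut t j j≤n)))))

  δ-term : Tree → ℕ → Lin (Tree × Tree)
  δ-term t i = pairᵀ (proj₁ (cut t (suc i))) (proj₂ (cut t i))

  δᵀ-cuts : ∀ t → δᵀ t ≋ ∑ (leaves t) (δ-term t)
  δᵀ-cuts t = begin
    δᵀ t
      ≡⟨ ≡.cong concat (List.map-upTo (λ i → contract (component (suc i) (Δᵀ t)) (component i (Δᵀ t))) n) ⟩
    ∑ n (λ i → contract (component (suc i) (Δᵀ t)) (component i (Δᵀ t)))
      ≈⟨ ∑-cong n (λ i i<n → bilin-cong _ (component-Δᵀ t (suc i) i<n) (component-Δᵀ t i (ℕₚ.<⇒≤ i<n))) ⟩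
    ∑ n (λ i → contract (single (cut t (suc i))) (single (cut t i)))
      ≈⟨ ∑-cong n (λ i _ → bilin-single (λ p q → pairᵀ (proj₁ p) (proj₂ q)) (cut t (suc i)) (cut t i)) ⟩
    ∑ n (δ-term t) ∎
    where
      open ≋-Reasoning
      n = leaves t

  pairᵀ-⋎ʳ : ∀ {l r} w → Is-just l → Is-just r → pairᵀ l (r ⋎ᴮ just w) ≋ lift (map₂ (_⋎ w)) (pairᵀ l r)
  pairᵀ-⋎ʳ {just a} {just b} w (just _) (just _) = ≋-sym (ext-single (single ∘ map₂ (_⋎ w)) (a , b))

  pairᵀ-⋎ˡ : ∀ t {l} r → Is-just l → pairᵀ (just t ⋎ᴮ l) r ≋ lift (map₁ (t ⋎_)) (pairᵀ l r)
  pairᵀ-⋎ˡ t {just a} nothing  (just _) = ≋-refl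
  pairᵀ-⋎ˡ t {just a} (just b) (just _) = ≋-sym (ext-single (single ∘ map₁ (t ⋎_)) (a , b))

  δ-term-⋎ˡ : ∀ t w i → i < leaves t → δ-term (t ⋎ w) i ≋ lift (map₂ (_⋎ w)) (δ-term t i)
  δ-term-⋎ˡ t w i i<n = ≋-trans
    (≋-reflexive (≡.cong₂ pairᵀ (≡.cong proj₁ (cut-⋎ˡ t w (suc i) i<n)) (≡.cong proj₂ (cut-⋎ˡ t w i (ℕₚ.<⇒≤ i<n)))))
    (pairᵀ-⋎ʳ w (cut-suc-is-justˡ t i) (cut-<-is-justʳ t i i<n))

  δ-term-⋎ʳ : ∀ t w j → δ-term (t ⋎ w) (leaves t + j) ≋ lift (map₁ (t ⋎_)) (δ-term w j)
  δ-term-⋎ʳ t w j = ≋-trans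
    (≋-reflexive (≡.cong₂ pairᵀ (≡.cong proj₁ (≡.trans (≡.cong (cut (t ⋎ w)) (≡.sym (ℕₚ.+-suc (leaves t) j))) (cut-⋎ʳ t w (suc j))))
                                (≡.cong proj₂ (cut-⋎ʳ t w j))))
    (pairᵀ-⋎ˡ t (proj₂ (cut w j)) (cut-suc-is-justˡ w j))

  δᵀ-⋎ : ∀ t w → δᵀ (t ⋎ w) ≋ lift (map₂ (_⋎ w)) (δᵀ t) ⊕ lift (map₁ (t ⋎_)) (δᵀ w)
  δᵀ-⋎ t w = begin
    δᵀ (t ⋎ w)
      ≈⟨ δᵀ-cuts (t ⋎ w) ⟩
    ∑ (n + m) (δ-term (t ⋎ w))
      ≡⟨ ∑-+ n m (δ-term (t ⋎ w)) ⟩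
    ∑ n (δ-term (t ⋎ w)) ⊕ ∑ m (δ-term (t ⋎ w) ∘ (n +_))
      ≈⟨ ⊕-cong (∑-cong n (δ-term-⋎ˡ t w)) (∑-cong m λ j _ → δ-term-⋎ʳ t w j) ⟩
    ∑ n (lift F ∘ δ-term t) ⊕ ∑ m (lift G ∘ δ-term w)
      ≡⟨ ≡.cong₂ _⊕_ (ext-∑ (single ∘ F) n (δ-term t)) (ext-∑ (single ∘ G) m (δ-term w)) ⟨
    lift F (∑ n (δ-term t)) ⊕ lift G (∑ m (δ-term w))
      ≈⟨ ⊕-cong (ext-congʳ (single ∘ F) (δᵀ-cuts t)) (ext-congʳ (single ∘ G) (δᵀ-cuts w)) ⟨
    lift F (δᵀ t) ⊕ lift G (δᵀ w)                                     ∎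
    where
      open ≋-Reasoning
      n = leaves t
      m = leaves w
      F G : Tree × Tree → Tree × Tree
      F = map₂ (_⋎ w)
      G = map₁ (t ⋎_)

module UnitalInfinitesimalBialgebra {c ℓ} (R : CommutativeRing c ℓ) where
  open CommutativeRing R using (-_; 1#)
  open FreeModuleProperties R
  open Coderivation R Δᴮ (- 1#)
  open Statements R using (Part1)

  coderivation-unitˡ : ∀ (μ : HB → HB → HB) → (∀ b → μ nothing b ≡ b) → ∀ b → IsCoderivationAt μ nothing b
  coderivation-unitˡ μ identityˡ b = begin
    Δᴮ (μ nothing b)
      ≡⟨ ≡.cong Δᴮ (identityˡ b) ⟩
    Δᴮ b
      ≈⟨ ⊕-⊖-cancel [] s (Δᴮ b) ⟨
    s ⊕ Δᴮ b ⊕ ⊖ s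
      ≈⟨ ⊕-congʳ (⊖ s) (⊕-cong left right) ⟨
    lift (map₂ (λ x → μ x b)) (Δᴮ nothing) ⊕ lift (map₁ (μ nothing)) (Δᴮ b) ⊕ ⊖ s ∎
    where
      open ≋-Reasoning
      s : Lin (HB × HB)
      s = single (nothing , b)
      left : lift (map₂ (λ x → μ x b)) (Δᴮ nothing) ≋ s
      left = ≋-trans (ext-single (single ∘ map₂ (λ x → μ x b)) (nothing , nothing))
                     (≋-reflexive (≡.cong (single ∘ (nothing ,_)) (identityˡ b)))
      right : lift (map₁ (μ nothing)) (Δᴮ b) ≋ Δᴮ b
      right = ≋-trans (lift-cong (Δᴮ b) λ p → ≡.cong (_, proj₂ p) (identityˡ (proj₁ p))) (ext-single-id (Δᴮ b))

  coderivation-unitʳ : ∀ (μ : HB → HB → HB) → (∀ a → μ a nothing ≡ a) → ∀ a → IsCoderivationAt μ a nothing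
  coderivation-unitʳ μ identityʳ a = begin
    Δᴮ (μ a nothing)
      ≡⟨ ≡.cong Δᴮ (identityʳ a) ⟩
    Δᴮ a
      ≈⟨ ≋-trans (⊕-⊖-cancel (Δᴮ a) s []) (⊕-identityʳ (Δᴮ a)) ⟨
    Δᴮ a ⊕ s ⊕ ⊖ s
      ≈⟨ ⊕-congʳ (⊖ s) (⊕-cong left right) ⟨
    lift (map₂ (λ x → μ x nothing)) (Δᴮ a) ⊕ lift (map₁ (μ a)) (Δᴮ nothing) ⊕ ⊖ s ∎
    where
      open ≋-Reasoning
      s : Lin (HB × HB)
      s = single (a , nothing)
      left : lift (map₂ (λ x → μ x nothing)) (Δᴮ a) ≋ Δᴮ a
      left = ≋-trans (lift-cong (Δᴮ a) λ p → ≡.cong (proj₁ p ,_) (identityʳ (proj₂ p))) (ext-single-id (Δᴮ a))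
      right : lift (map₁ (μ a)) (Δᴮ nothing) ≋ s
      right = ≋-trans (ext-single (single ∘ map₁ (μ a)) (nothing , nothing))
                      (≋-reflexive (≡.cong (single ∘ (_, nothing)) (identityʳ a)))

  Δ-coderivation-⋎ : ∀ a b → IsCoderivationAt _⋎ᴮ_ a b
  Δ-coderivation-⋎ nothing  b        = coderivation-unitˡ _⋎ᴮ_ (λ _ → ≡.refl) b
  Δ-coderivation-⋎ (just t) nothing  = coderivation-unitʳ _⋎ᴮ_ ⋎ᴮ-identityʳ (just t)
  Δ-coderivation-⋎ (just t) (just w) = ≋-refl

  Δ-coassociative : ∀ a → IsCoassociativeAt a
  Δ-coassociative nothing        = ≋-refl
  Δ-coassociative (just leaf)    = ≋-refl
  Δ-coassociative (just (t ⋎ w)) =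
    coassociative-μ Δ-coderivation-⋎ (just t) (just w) (Δ-coassociative (just t)) (Δ-coassociative (just w))

  Δ-coderivation-⋌ : ∀ a b → IsCoderivationAt _⋌ᴮ_ a b
  Δ-coderivation-⋌ nothing  b                 = coderivation-unitˡ _⋌ᴮ_ (λ _ → ≡.refl) b
  Δ-coderivation-⋌ (just t) nothing           = coderivation-unitʳ _⋌ᴮ_ ⋌ᴮ-identityʳ (just t)
  Δ-coderivation-⋌ (just t) (just leaf)       = ≋-trans (Δ-coderivation-⋎ (just t) (just leaf))
    (⊕-congʳ _ (⊕-congʳ _ (lift-cong (Δᵀ t) λ p → ≡.cong (proj₁ p ,_) (⋎ᴮ-leaf≡⋌ᴮ-leaf (proj₂ p)))))
  Δ-coderivation-⋌ (just t) (just (w₁ ⋎ w₂)) = coderivation-graft _⋌ᴮ_ _⋎ᴮ_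
    (λ a → ⋌ᴮ-⋎ᴮ-assocˡ a w₁ w₂) (⋌ᴮ-⋎ᴮ-assocʳ t w₁)
    (Δ-coderivation-⋌ (just t) (just w₁)) (Δ-coderivation-⋎ (just w₁) (just w₂))
    (Δ-coderivation-⋎ (just (t ⋌ᵀ w₁)) (just w₂))

  part1 : Part1
  part1 = (λ x y z → coeff-≈ (bilin-assoc _⋌ᴮ_ ⋌ᴮ-assoc x y z))
        , (λ x → coeff-≈ (bilin-identityˡ _⋌ᴮ_ (λ _ → ≡.refl) x))
        , (λ x → coeff-≈ (bilin-identityʳ _⋌ᴮ_ ⋌ᴮ-identityʳ x))
        , (λ x → coeff-≈ (coassociative-ext Δ-coassociative x))
        , (λ x y → coeff-≈ (coderivation-ext Δ-coderivation-⋌ x y))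

module InfinitesimalBialgebra {c ℓ} (R : CommutativeRing c ℓ) where
  open CommutativeRing R using (0#)
  open FreeModuleProperties R
  open CutExpansion R
  open Coderivation R δᵀ 0#
  open Statements R using (Part2; Part3)

  δ-coderivation-⋎ : ∀ t w → IsCoderivationAt _⋎_ t w
  δ-coderivation-⋎ t w = ≋-trans (δᵀ-⋎ t w) (≋-sym (⊕-scale-zero _ (single (t , w))))

  δ-coassociative : ∀ t → IsCoassociativeAt t
  δ-coassociative leaf    = ≋-refl
  δ-coassociative (t ⋎ w) = coassociative-μ δ-coderivation-⋎ t w (δ-coassociative t) (δ-coassociative w)

  δ-coderivation-⋌ : ∀ t w → IsCoderivationAt _⋌ᵀ_ t w
  δ-coderivation-⋌ t leaf      = δ-coderivation-⋎ t leaf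
  δ-coderivation-⋌ t (w₁ ⋎ w₂) = coderivation-graft _⋌ᵀ_ _⋎_ (λ _ → ≡.refl) (λ _ → ≡.refl)
    (δ-coderivation-⋌ t w₁) (δ-coderivation-⋎ w₁ w₂) (δ-coderivation-⋎ (t ⋌ᵀ w₁) w₂)

  part2 : Part2
  part2 t w = coeff-≈ (≋-trans (δᵀ-⋎ t w)
    (≋-sym (⊕-cong (⊗ₘ-singles id (_⋎ w) (δᵀ t)) (⊗ₘ-singles (t ⋎_) id (δᵀ w)))))

  part3 : Part3
  part3 = (λ x → coeff-≈ (coassociative-ext δ-coassociative x))
        , (λ t w → coeff-≈ (≋-trans (≋-trans (δ-coderivation-⋌ t w) (⊕-scale-zero _ (single (t , w))))
                             (≋-sym (⊕-cong (⊗ₘ-singles id (_⋌ᵀ w) (δᵀ t)) (⊗ₘ-singles (t ⋌ᵀ_) id (δᵀ w))))))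

lemma2p25 : ∀ {c ℓ} (R : CommutativeRing c ℓ) → IsField R →
    Statements.Part1 R × Statements.Part2 R × Statements.Part3 R
lemma2p25 R _ = UnitalInfinitesimalBialgebra.part1 R , InfinitesimalBialgebra.part2 R , InfinitesimalBialgebra.part3 R
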